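{- Let $a,b\ge0$ be integers and let $\mathbf{x}\in\mathcal{X}_F$. If $10^a10^b1$ is a factor of $\mathbf{x}$, then $|a-b|\le1$.
   Context: Let $\mathcal{A}=\{0,1\}$. For a finite word $v=v_1\cdots v_n$ over $\mathcal{A}$, $\tilde v=v_n\cdots v_1$ is its mirror word (with $\tilde\lambda=\lambda$ for the empty word), and $0^k$ denotes the word of $k$ zeros. Let $F=\{0v01\tilde v1,\ 1\tilde v10v0 : v\in\mathcal{A}^*\}$, and let $\mathcal{X}_F$ be the set of bi-infinite words $\mathbf{x}\in\mathcal{A}^{\mathbb{Z}}$ none of whose finite factors (contiguous subwords) belongs to $F$. -}

module Defs where

open import Data.Nat using (ℕ)
open import Data.Bool using (Bool; true; false)
open import Data.List using (List; []; _∷_; _++_; reverse; replicate)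
open import Data.Integer using (ℤ; _+_; +_)
open import Data.Product using (Σ; _×_)
open import Data.Sum using (_⊎_)
open import Data.Unit using (⊤)
open import Relation.Binary.PropositionalEquality using (_≡_)
open import Relation.Nullary using (¬_)

𝟘 𝟙 : Bool
𝟘 = false
𝟙 = true

Word : Set
Word = List Bool

BiWord : Set
BiWord = ℤ → Bool

OccursAt : BiWord → ℤ → Word → Set
OccursAt x i []      = ⊤
OccursAt x i (c ∷ w) = (x i ≡ c) × OccursAt x (i + + 1) w

IsFactor : Word → BiWord → Set
IsFactor w x = Σ ℤ λ i → OccursAt x i w

mirror : Word → Word
mirror = reverse

InF : Word → Set
InF w = Σ Word λ v →
          (w ≡ (𝟘 ∷ v) ++ (𝟘 ∷ 𝟙 ∷ mirror v) ++ (𝟙 ∷ []))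
        ⊎ (w ≡ (𝟙 ∷ mirror v) ++ (𝟙 ∷ 𝟘 ∷ v) ++ (𝟘 ∷ []))

InXF : BiWord → Set
InXF x = (w : Word) → IsFactor w x → ¬ InF w

w10a10b1 : ℕ → ℕ → Word
w10a10b1 a b = (𝟙 ∷ replicate a 𝟘) ++ (𝟙 ∷ replicate b 𝟘) ++ (𝟙 ∷ [])

{-# OPTIONS --safe #-}
-- If a ≥ b + 2, the factor 10ᵃ10ᵇ1 ends in 0ᵇ⁺²10ᵇ1 = 0v01ṽ1 with v = 0ᵇ; if b ≥ a + 2, it
-- begins with 10ᵃ10ᵃ⁺² = 1ṽ10v0 with v = 0ᵃ. Either way x would contain a word of F.
module Submission where

open import Defs
open import Data.Nat using (ℕ; zero; suc; _+_; _≤_; z≤n; s≤s)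
open import Data.Nat.Properties using (+-comm)
open import Data.List using ([]; _∷_; _++_; reverse; replicate)
open import Data.List.Properties using (++-assoc; ++-identityʳ; unfold-reverse)
open import Data.Product using (_×_; _,_; ∃)
open import Data.Sum using (_⊎_; inj₁; inj₂; map)
open import Data.Empty using (⊥-elim)
open import Relation.Binary.PropositionalEquality
  using (_≡_; refl; trans; cong; subst; module ≡-Reasoning)

≤⊎≡suc+ : ∀ m n → m ≤ n ⊎ ∃ λ k → m ≡ suc n + k
≤⊎≡suc+ zero    n       = inj₁ z≤n
≤⊎≡suc+ (suc m) zero    = inj₂ (m , refl)
≤⊎≡suc+ (suc m) (suc n) = map s≤s (λ (k , m≡) → k , cong suc m≡) (≤⊎≡suc+ m n)

module _ {A : Set} where

  replicate-+ : ∀ m n (c : A) → replicate (m + n) c ≡ replicate m c ++ replicate n c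
  replicate-+ zero    n c = refl
  replicate-+ (suc m) n c = cong (c ∷_) (replicate-+ m n c)

  replicate-++-∷ : ∀ n (c : A) xs → replicate n c ++ c ∷ xs ≡ c ∷ replicate n c ++ xs
  replicate-++-∷ zero    c xs = refl
  replicate-++-∷ (suc n) c xs = cong (c ∷_) (replicate-++-∷ n c xs)

  replicate-∷ʳ : ∀ n (c : A) → replicate n c ++ c ∷ [] ≡ c ∷ replicate n c
  replicate-∷ʳ n c = trans (replicate-++-∷ n c []) (cong (c ∷_) (++-identityʳ _))

  reverse-replicate : ∀ n (c : A) → reverse (replicate n c) ≡ replicate n c
  reverse-replicate zero    c = refl
  reverse-replicate (suc n) c = begin
    reverse (c ∷ replicate n c)        ≡⟨ unfold-reverse c (replicate n c) ⟩
    reverse (replicate n c) ++ c ∷ []  ≡⟨ cong (_++ c ∷ []) (reverse-replicate n c) ⟩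
    replicate n c ++ c ∷ []            ≡⟨ replicate-∷ʳ n c ⟩
    c ∷ replicate n c                  ∎
    where open ≡-Reasoning

OccursAt-++⁻ˡ : ∀ {x i} u v → OccursAt x i (u ++ v) → OccursAt x i u
OccursAt-++⁻ˡ []      v o       = _
OccursAt-++⁻ˡ (c ∷ u) v (e , o) = e , OccursAt-++⁻ˡ u v o

IsFactor-++⁻ˡ : ∀ {x} u v → IsFactor (u ++ v) x → IsFactor u x
IsFactor-++⁻ˡ u v (i , o) = i , OccursAt-++⁻ˡ u v o

IsFactor-++⁻ʳ : ∀ {x} u v → IsFactor (u ++ v) x → IsFactor v x
IsFactor-++⁻ʳ []      v f           = f
IsFactor-++⁻ʳ (c ∷ u) v (i , _ , o) = IsFactor-++⁻ʳ u v (_ , o)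

zeros : ℕ → Word
zeros n = replicate n 𝟘

longLeftGap longRightGap : ℕ → Word
longLeftGap  n = zeros (2 + n) ++ 𝟙 ∷ zeros n ++ 𝟙 ∷ []
longRightGap n = 𝟙 ∷ zeros n ++ 𝟙 ∷ zeros (2 + n)

longLeftGap∈F : ∀ n → InF (longLeftGap n)
longLeftGap∈F n = zeros n , inj₁ (cong (𝟘 ∷_) (begin
  𝟘 ∷ zeros n ++ 𝟙 ∷ zeros n ++ 𝟙 ∷ []                 ≡⟨ replicate-++-∷ n 𝟘 _ ⟨
  zeros n ++ 𝟘 ∷ 𝟙 ∷ zeros n ++ 𝟙 ∷ []                 ≡⟨ cong (λ v → zeros n ++ 𝟘 ∷ 𝟙 ∷ v ++ 𝟙 ∷ [])
                                                              (reverse-replicate n 𝟘) ⟨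
  zeros n ++ 𝟘 ∷ 𝟙 ∷ mirror (zeros n) ++ 𝟙 ∷ []        ∎))
  where open ≡-Reasoning

longRightGap∈F : ∀ n → InF (longRightGap n)
longRightGap∈F n = zeros n , inj₂ (cong (𝟙 ∷_) (begin
  zeros n ++ 𝟙 ∷ 𝟘 ∷ 𝟘 ∷ zeros n                 ≡⟨ cong (λ v → zeros n ++ 𝟙 ∷ 𝟘 ∷ v) (replicate-∷ʳ n 𝟘) ⟨
  zeros n ++ 𝟙 ∷ 𝟘 ∷ zeros n ++ 𝟘 ∷ []           ≡⟨ cong (_++ 𝟙 ∷ 𝟘 ∷ zeros n ++ 𝟘 ∷ [])
                                                        (reverse-replicate n 𝟘) ⟨
  mirror (zeros n) ++ 𝟙 ∷ 𝟘 ∷ zeros n ++ 𝟘 ∷ []  ∎))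
  where open ≡-Reasoning

w10a10b1-longLeftGap-suffix : ∀ b k → w10a10b1 (2 + b + k) b ≡ (𝟙 ∷ zeros k) ++ longLeftGap b
w10a10b1-longLeftGap-suffix b k = cong (𝟙 ∷_) (begin
  zeros (2 + b + k) ++ rest            ≡⟨ cong (λ n → zeros n ++ rest) (+-comm (2 + b) k) ⟩
  zeros (k + (2 + b)) ++ rest          ≡⟨ cong (_++ rest) (replicate-+ k (2 + b) 𝟘) ⟩
  (zeros k ++ zeros (2 + b)) ++ rest   ≡⟨ ++-assoc (zeros k) (zeros (2 + b)) rest ⟩
  zeros k ++ longLeftGap b             ∎)
  where
  open ≡-Reasoning
  rest : Word
  rest = 𝟙 ∷ zeros b ++ 𝟙 ∷ []

w10a10b1-longRightGap-prefix : ∀ a k → w10a10b1 a (2 + a + k) ≡ longRightGap a ++ zeros k ++ 𝟙 ∷ []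
w10a10b1-longRightGap-prefix a k = cong (𝟙 ∷_) (begin
  zeros a ++ 𝟙 ∷ zeros (2 + a + k) ++ end              ≡⟨ cong (λ v → zeros a ++ 𝟙 ∷ v ++ end)
                                                             (replicate-+ (2 + a) k 𝟘) ⟩
  zeros a ++ 𝟙 ∷ (zeros (2 + a) ++ zeros k) ++ end    ≡⟨ cong (λ v → zeros a ++ 𝟙 ∷ v)
                                                             (++-assoc (zeros (2 + a)) (zeros k) end) ⟩
  zeros a ++ (𝟙 ∷ zeros (2 + a)) ++ zeros k ++ end    ≡⟨ ++-assoc (zeros a) (𝟙 ∷ zeros (2 + a)) _ ⟨
  (zeros a ++ 𝟙 ∷ zeros (2 + a)) ++ zeros k ++ end    ∎)
  where
  open ≡-Reasoning
  end : Word
  end = 𝟙 ∷ []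

lemma5p1 : (a b : ℕ) (x : BiWord) → InXF x → IsFactor (w10a10b1 a b) x →
    (a ≤ suc b) × (b ≤ suc a)
lemma5p1 a b x x∈XF 10ᵃ10ᵇ1 = a≤1+b , b≤1+a
  where
  factor : ∀ {w} → w10a10b1 a b ≡ w → IsFactor w x
  factor eq = subst (λ w → IsFactor w x) eq 10ᵃ10ᵇ1

  a≤1+b : a ≤ suc b
  a≤1+b with ≤⊎≡suc+ a (suc b)
  ... | inj₁ a≤ = a≤
  ... | inj₂ (k , refl) = ⊥-elim (x∈XF _
    (IsFactor-++⁻ʳ (𝟙 ∷ zeros k) _ (factor (w10a10b1-longLeftGap-suffix b k)))
    (longLeftGap∈F b))

  b≤1+a : b ≤ suc a
  b≤1+a with ≤⊎≡suc+ b (suc a)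
  ... | inj₁ b≤ = b≤
  ... | inj₂ (k , refl) = ⊥-elim (x∈XF _
    (IsFactor-++⁻ˡ _ (zeros k ++ 𝟙 ∷ []) (factor (w10a10b1-longRightGap-prefix a k)))
    (longRightGap∈F a))
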